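{- For all integers $n,m\ge0$, with $\underline{n}:=\bigcup_{y\in Y_n}y=Y_n$ the total grove of degree $n$, one has $\underline{n}\times\underline{m}=\underline{nm}$.
   Context: A planar binary tree of degree $n\ge 0$ is a planar rooted tree (up to planar isotopy) with $n+1$ leaves in which every internal vertex has exactly two inputs; $Y_n$ is the set of these trees, $Y_0=\{|\}$, and the unique tree of $Y_1$ is denoted $1$. For $x\in Y_p$, $y\in Y_q$ the grafting $x\vee y\in Y_{p+q+1}$ joins the roots of $x$ and $y$ to a new vertex with a new root; every $x\in Y_n$, $n\ge1$, decomposes uniquely as $x=x^l\vee x^r$. Tamari order on $Y_n$: the smallest partial order with $(a\vee b)\vee c\le a\vee(b\vee c)$, and $a\le b\Rightarrow a\vee c\le b\vee c,\ c\vee a\le c\vee b$. $x/y$ identifies the root of $x$ with the leftmost leaf of $y$; $x\backslash y$ identifies the rightmost leaf of $x$ with the root of $y$. Sum of trees: $x+y:=\{z\in Y_{p+q}: x/y\le z\le x\backslash y\}$. A grove is a nonempty subset of some $Y_n$; all operations on groves are extended from trees by distributivity (union over pairs, counted with multiplicity), and grafting with a grove is elementwise. Left/Right sums of trees: $x\dashv y:=x^l\vee(x^r+y)$ for $x\ne|$, $x\vdash y:=(x+y^l)\vee y^r$ for $y\ne|$, $|\dashv y=|=y\vdash|$ for $y\ne|$, and by convention $|\dashv|=|\vdash|=|$. Product: for a tree $x$ and a grove $y$ define $W_|(y):=|$ and $W_x(y):=(W_{x^l}(y)\vdash y)\dashv W_{x^r}(y)$ for $x=x^l\vee x^r$; set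 $x\times y:=W_x(y)$, and for a grove $X$, $X\times y:=\bigcup_{x\in X}x\times y$. -}

module Defs where

open import Data.Nat using (ℕ; zero; suc; _+_; _*_)
open import Data.Product using (Σ; ∃; _×_; _,_)
open import Relation.Binary.PropositionalEquality using (_≡_)

-- Planar binary trees: leaf = | , node l r = l ∨ r.
data Tree : Set where
  leaf : Tree
  node : Tree → Tree → Tree

deg : Tree → ℕ
deg leaf = zero
deg (node l r) = suc (deg l + deg r)

-- x / y : root of x identified with leftmost leaf of y
_/ᵗ_ : Tree → Tree → Tree
x /ᵗ leaf = x
x /ᵗ node l r = node (x /ᵗ l) r

-- x \ y : rightmost leaf of x identified with root of y
_∖ᵗ_ : Tree → Tree → Tree
leaf ∖ᵗ y = y
node l r ∖ᵗ y = node l (r ∖ᵗ y)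

data _≤T_ : Tree → Tree → Set where
  ≤T-refl  : ∀ {x} → x ≤T x
  ≤T-trans : ∀ {x y z} → x ≤T y → y ≤T z → x ≤T z
  ≤T-rot   : ∀ {a b c} → node (node a b) c ≤T node a (node b c)
  ≤T-left  : ∀ {a b c} → a ≤T b → node a c ≤T node b c
  ≤T-right : ∀ {a b c} → a ≤T b → node c a ≤T node c b

Grove : Set₁
Grove = Tree → Set

single : Tree → Grove
single x z = z ≡ x

total : ℕ → Grove
total n z = deg z ≡ n

sumT : Tree → Tree → Grove
sumT x y z = (deg z ≡ deg x + deg y) × ((x /ᵗ y) ≤T z) × (z ≤T (x ∖ᵗ y))

graftG : Grove → Grove → Grove
graftG X Y z = ∃ λ x → ∃ λ y → X x × Y y × (z ≡ node x y)

_⊣ᵗ_ : Tree → Tree → Grove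
leaf ⊣ᵗ y = single leaf
node xl xr ⊣ᵗ y = graftG (single xl) (sumT xr y)

_⊢ᵗ_ : Tree → Tree → Grove
x ⊢ᵗ leaf = single leaf
x ⊢ᵗ node yl yr = graftG (sumT x yl) (single yr)

_⊣_ : Grove → Grove → Grove
(X ⊣ Y) z = ∃ λ x → ∃ λ y → X x × Y y × (x ⊣ᵗ y) z

_⊢_ : Grove → Grove → Grove
(X ⊢ Y) z = ∃ λ x → ∃ λ y → X x × Y y × (x ⊢ᵗ y) z

W : Tree → Grove → Grove
W leaf Y = single leaf
W (node xl xr) Y = (W xl Y ⊢ Y) ⊣ W xr Y

_⊠_ : Grove → Grove → Grove
(X ⊠ Y) z = ∃ λ x → X x × W x Y z

-- Degrees add under sums and graftings, so every tree of W_x(Y_m) has degree |x|·m (for m = 0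
-- the grove collapses to {|}, since x ⊢ | = | and | ⊣ y = |).  Conversely let m > 0 and
-- z = zl ∨ zr of degree (n+1)m.  Divide: |zl| = nl·m + r with r < m, and then
-- |zr| = (m-1-r) + nr·m with nl + nr = n.  Every tree of degree p + q lies in a sum of a tree
-- of degree p and one of degree q, so zl ∈ w + yl and zr ∈ yr + v with |w| = nl·m, |yl| = r,
-- |yr| = m-1-r, |v| = nr·m.  Then z ∈ (w ⊢ (yl ∨ yr)) ⊣ v, and by induction on n the trees
-- w and v lie in W_xl(Y_m) and W_xr(Y_m) for some xl ∈ Y_nl, xr ∈ Y_nr.
module Submission where

open import Defs
open import Data.Nat using (ℕ; _*_)
open import Data.Product using (_×_)
open import Data.Nat using (zero; suc; _+_; _≤_; _<_; _≤?_; s≤s)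
open import Data.Nat.Properties
open import Data.Nat.DivMod using (_/_; _%_; m≡m%n+[m/n]*n; m%n<n; m/n*n≤m)
open import Data.Nat.Induction using (<-rec)
open import Data.Nat.Tactic.RingSolver using (solve-∀)
open import Data.Product using (∃; ∃₂; _,_)
open import Relation.Nullary using (yes; no)
open import Relation.Binary.PropositionalEquality

∖ᵗ-node-≤T : ∀ x y c → node (x ∖ᵗ y) c ≤T (x ∖ᵗ node y c)
∖ᵗ-node-≤T leaf       y c = ≤T-refl
∖ᵗ-node-≤T (node a b) y c = ≤T-trans ≤T-rot (≤T-right (∖ᵗ-node-≤T b y c))

/ᵗ-node-≤T : ∀ a b y → (node a b /ᵗ y) ≤T node a (b /ᵗ y)
/ᵗ-node-≤T a b leaf       = ≤T-refl
/ᵗ-node-≤T a b (node l r) = ≤T-trans (≤T-left (/ᵗ-node-≤T a b l)) ≤T-rot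

sumT-extendʳ : ∀ {x y z} c → sumT x y z → sumT x (node y c) (node z c)
sumT-extendʳ {x} {y} {z} c (dz , lo , hi) =
  degree , ≤T-left lo , ≤T-trans (≤T-left hi) (∖ᵗ-node-≤T x y c)
  where
  degree : suc (deg z + deg c) ≡ deg x + suc (deg y + deg c)
  degree = begin
    suc (deg z + deg c)            ≡⟨ cong (λ d → suc (d + deg c)) dz ⟩
    suc (deg x + deg y + deg c)    ≡⟨ cong suc (+-assoc (deg x) (deg y) (deg c)) ⟩
    suc (deg x + (deg y + deg c))  ≡⟨ +-suc (deg x) (deg y + deg c) ⟨
    deg x + suc (deg y + deg c)    ∎
    where open ≡-Reasoning

sumT-extendˡ : ∀ {x y z} a → sumT x y z → sumT (node a x) y (node a z)
sumT-extendˡ {x} {y} {z} a (dz , lo , hi) =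
  degree , ≤T-trans (/ᵗ-node-≤T a x y) (≤T-right lo) , ≤T-right hi
  where
  degree : suc (deg a + deg z) ≡ suc (deg a + deg x + deg y)
  degree = cong suc (trans (cong (deg a +_) dz) (sym (+-assoc (deg a) (deg x) (deg y))))

sumT-split : ∀ z p q → deg z ≡ p + q →
             ∃₂ λ x y → deg x ≡ p × deg y ≡ q × sumT x y z
sumT-split leaf zero zero refl = leaf , leaf , refl , refl , refl , ≤T-refl , ≤T-refl
sumT-split (node zl zr) p q dz with p ≤? deg zl
... | yes p≤dzl =
  let t , p+t≡dzl = m≤n⇒∃[o]m+o≡n p≤dzl
      x , y , dx , dy , zl∈x+y = sumT-split zl p t (sym p+t≡dzl)
  in  x , node y zr , dx , degree dy p+t≡dzl , sumT-extendʳ zr zl∈x+y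
  where
  degree : ∀ {t d} → d ≡ t → p + t ≡ deg zl → suc (d + deg zr) ≡ q
  degree {t} refl p+t≡dzl = +-cancelˡ-≡ p _ _ (begin
    p + suc (t + deg zr)    ≡⟨ +-suc p (t + deg zr) ⟩
    suc (p + (t + deg zr))  ≡⟨ cong suc (+-assoc p t (deg zr)) ⟨
    suc (p + t + deg zr)    ≡⟨ cong (λ d → suc (d + deg zr)) p+t≡dzl ⟩
    suc (deg zl + deg zr)   ≡⟨ dz ⟩
    p + q                   ∎)
    where open ≡-Reasoning
... | no p≰dzl =
  let p′ , 1+dzl+p′≡p = m≤n⇒∃[o]m+o≡n (≰⇒> p≰dzl)
      x , y , dx , dy , zr∈x+y = sumT-split zr p′ q (degree 1+dzl+p′≡p)
  in  node zl x , y , trans (cong (λ d → suc (deg zl + d)) dx) 1+dzl+p′≡p , dy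
    , sumT-extendˡ zl zr∈x+y
  where
  degree : ∀ {p′} → suc (deg zl + p′) ≡ p → deg zr ≡ p′ + q
  degree {p′} refl = +-cancelˡ-≡ (suc (deg zl)) _ _
    (trans dz (+-assoc (suc (deg zl)) p′ q))

W-total-zero⇒leaf : ∀ x {z} → W x (total 0) z → z ≡ leaf
W-total-zero⇒leaf leaf       refl = refl
W-total-zero⇒leaf (node _ _) (.leaf , _ , (_ , leaf , _ , _ , refl) , _ , refl) = refl

leaf∈W-total-zero : ∀ x → W x (total 0) leaf
leaf∈W-total-zero leaf         = refl
leaf∈W-total-zero (node xl xr) =
  leaf , leaf , (leaf , leaf , leaf∈W-total-zero xl , refl , refl) , leaf∈W-total-zero xr , refl

deg-W-total-suc : ∀ k x {z} → W x (total (suc k)) z → deg z ≡ deg x * suc k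
deg-W-total-suc k leaf refl = refl
deg-W-total-suc k (node xl xr)
  (.(node s yr) , v , (w , node yl yr , w∈Wxl , dy , (s , .yr , (ds , _) , refl , refl))
                , v∈Wxr , (.s , t , refl , (dt , _) , refl)) = begin
  suc (deg s + deg t)                          ≡⟨ cong suc (cong₂ _+_ ds dt) ⟩
  suc ((deg w + deg yl) + (deg yr + deg v))    ≡⟨ regroup (deg w) (deg yl) (deg yr) (deg v) ⟩
  deg w + suc (deg yl + deg yr) + deg v        ≡⟨ cong (λ d → deg w + d + deg v) dy ⟩
  deg w + suc k + deg v                        ≡⟨ cong₂ (λ a b → a + suc k + b)
                                                        (deg-W-total-suc k xl w∈Wxl)
                                                        (deg-W-total-suc k xr v∈Wxr) ⟩
  deg xl * suc k + suc k + deg xr * suc k      ≡⟨ distribute (deg xl) (deg xr) (suc k) ⟨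
  suc (deg xl + deg xr) * suc k                ∎
  where
  open ≡-Reasoning
  regroup : ∀ a b c d → suc ((a + b) + (c + d)) ≡ a + suc (b + c) + d
  regroup = solve-∀
  distribute : ∀ a b m → suc (a + b) * m ≡ a * m + m + b * m
  distribute = solve-∀

deg-W-total : ∀ m x {z} → W x (total m) z → deg z ≡ deg x * m
deg-W-total zero    x z∈Wx rewrite W-total-zero⇒leaf x z∈Wx = sym (*-zeroʳ (deg x))
deg-W-total (suc k) x z∈Wx = deg-W-total-suc k x z∈Wx

W-node-intro : ∀ {Y xl xr w yl yr v zl zr} →
               W xl Y w → Y (node yl yr) → W xr Y v → sumT w yl zl → sumT yr v zr →
               W (node xl xr) Y (node zl zr)
W-node-intro {yl = yl} {yr} {zl = zl} {zr} w∈Wxl y∈Y v∈Wxr zl∈w+yl zr∈yr+v =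
  node zl yr , _ , (_ , node yl yr , w∈Wxl , y∈Y , (zl , yr , zl∈w+yl , refl , refl))
             , v∈Wxr , (zl , zr , refl , zr∈yr+v , refl)

divide-node-degree : ∀ k n a b → suc (a + b) ≡ suc n * suc k →
  ∃₂ λ nl nr → ∃₂ λ r s →
    a ≡ nl * suc k + r × b ≡ s + nr * suc k × suc (r + s) ≡ suc k × nl + nr ≡ n
divide-node-degree k n a b dz =
  let s , r+s≡k = m≤n⇒∃[o]m+o≡n (≤-pred (m%n<n a (suc k)))
      nr , nl+nr≡n = m≤n⇒∃[o]m+o≡n (≤-pred nl<1+n)
  in  nl , nr , r , s , a≡ , remainder {nl = nl} {nr} {r} {s} r+s≡k nl+nr≡n a≡ dz
    , cong suc r+s≡k , nl+nr≡n
  where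
  nl = a / suc k
  r = a % suc k
  a≡ : a ≡ nl * suc k + r
  a≡ = trans (m≡m%n+[m/n]*n a (suc k)) (+-comm r (nl * suc k))
  nl<1+n : nl < suc n
  nl<1+n = *-cancelʳ-< (suc k) nl (suc n)
    (≤-<-trans (m/n*n≤m a (suc k)) (subst (a <_) dz (s≤s (m≤m+n a b))))
  remainder : ∀ {k n a b nl nr r s} → r + s ≡ k → nl + nr ≡ n → a ≡ nl * suc k + r →
              suc (a + b) ≡ suc n * suc k → b ≡ s + nr * suc k
  remainder {b = b} {nl} {nr} {r} {s} refl refl refl dz =
    +-cancelˡ-≡ (suc (nl * suc (r + s) + r)) b _ (trans dz (expand nl nr r s))
    where
    expand : ∀ nl nr r s → suc (nl + nr) * suc (r + s) ≡
                           suc (nl * suc (r + s) + r) + (s + nr * suc (r + s))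
    expand = solve-∀

W-total-suc-covers : ∀ k n z → deg z ≡ n * suc k → ∃ λ x → deg x ≡ n × W x (total (suc k)) z
W-total-suc-covers k = <-rec Covers covers
  where
  Covers : ℕ → Set
  Covers n = ∀ z → deg z ≡ n * suc k → ∃ λ x → deg x ≡ n × W x (total (suc k)) z
  covers : ∀ n → (∀ {n′} → n′ < n → Covers n′) → Covers n
  covers zero    _  leaf         refl = leaf , refl , refl
  covers (suc n) ih (node zl zr) dz =
    let nl , nr , r , s , dzl , dzr , r+s+1≡m , nl+nr≡n =
          divide-node-degree k n (deg zl) (deg zr) dz
        w , yl , dw , dyl , zl∈w+yl = sumT-split zl (nl * suc k) r dzl
        yr , v , dyr , dv , zr∈yr+v = sumT-split zr s (nr * suc k) dzr
        xl , dxl , w∈Wxl = ih (s≤s (subst (nl ≤_) nl+nr≡n (m≤m+n nl nr))) w dw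
        xr , dxr , v∈Wxr = ih (s≤s (subst (nr ≤_) nl+nr≡n (m≤n+m nr nl))) v dv
        y∈Ym = trans (cong suc (cong₂ _+_ dyl dyr)) r+s+1≡m
    in  node xl xr , cong suc (trans (cong₂ _+_ dxl dxr) nl+nr≡n)
      , W-node-intro {xl = xl} {xr} {w} {yl} {yr} {v} w∈Wxl y∈Ym v∈Wxr zl∈w+yl zr∈yr+v

leftComb : ℕ → Tree
leftComb zero    = leaf
leftComb (suc n) = node (leftComb n) leaf

deg-leftComb : ∀ n → deg (leftComb n) ≡ n
deg-leftComb zero    = refl
deg-leftComb (suc n) = cong suc (trans (+-identityʳ _) (deg-leftComb n))

theorem6p4 : ∀ (n m : ℕ) (z : Tree) →
    ((total n ⊠ total m) z → total (n * m) z) × (total (n * m) z → (total n ⊠ total m) z)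
theorem6p4 n m z = product⊆total , total⊆product m z
  where
  product⊆total : (total n ⊠ total m) z → total (n * m) z
  product⊆total (x , refl , z∈Wx) = deg-W-total m x z∈Wx
  total⊆product : ∀ m z → total (n * m) z → (total n ⊠ total m) z
  total⊆product zero    leaf       _  = leftComb n , deg-leftComb n , leaf∈W-total-zero (leftComb n)
  total⊆product zero    (node _ _) dz with () ← trans dz (*-zeroʳ n)
  total⊆product (suc k) z          dz = W-total-suc-covers k n z dz
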